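{- Let $M$ be a typed term and let $A,B$ be normal forms that are both direct approximations of $M$. Then $A$ and $B$ have a least upper bound $A\sqcup B$ with respect to $\preceq$, $A\sqcup B$ is a normal form, and $A\sqcup B$ is a direct approximation of $M$.
   Context: Types: type expressions $\sigma ::= t \mid \sigma+\sigma \mid \sigma\times\sigma\mid \sigma\to\sigma\mid \mu t.\sigma\mid \mathrm{void}$ (types = closed ones); equivalence $\sigma\approx\tau$ iff $\sigma$ and $\tau$ have the same (possibly infinite) unfolding into simple types (built from $\mathrm{void},+,\times,\to$), i.e. the same type tree. Terms: variables $x^\sigma$ for each type $\sigma$; constants for all types $\sigma,\tau,\rho$: $0_{\sigma,\tau}:\sigma\to(\sigma+\tau)$, $1_{\sigma,\tau}:\tau\to(\sigma+\tau)$, $\mathrm{case}_{\sigma,\tau,\rho}:(\sigma+\tau)\to(\sigma\to\rho)\to(\tau\to\rho)\to\rho$, $\mathrm{pcase}_{\sigma,\tau,\rho}:(\sigma+\tau)\to\rho\to\rho\to\rho$, $\mathrm{pair}_{\sigma,\tau}:\sigma\to\tau\to(\sigma\times\tau)$, $\mathrm{fst}_{\sigma,\tau}:(\sigma\times\tau)\to\sigma$, $\mathrm{snd}_{\sigma,\tau}:(\sigma\times\tau)\to\tau$, $\Omega_\sigma:\sigma$. Typing: constants have their types; $x^\sigma:\sigma$; $M:\tau\Rightarrow\lambda x^\sigma.M:\sigma\to\tau$; $M:\sigma\to\tau,N:\sigma\Rightarrow MN:\tau$; $M:\sigma,\sigma\approx\tau\Rightarrow M:\tau$. Terms modulo $\alpha$-conversion;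 $(M,N)=\mathrm{pair}\,M\,N$. Reduction $\to$: least relation containing $\beta$ ($(\lambda x.M)N\to M[x:=N]$), closed under application in either position and under $\lambda$, and containing (for arbitrary terms $x,y,z,w,y_i,z_i$): $\mathrm{case}(0x)yz\to yx$; $\mathrm{case}(1x)yz\to zx$; $\mathrm{fst}(x,y)\to x$; $\mathrm{snd}(x,y)\to y$; $\mathrm{pcase}(0x)yz\to y$; $\mathrm{pcase}(1x)yz\to z$; $\mathrm{pcase}_{\sigma,\tau,\rho_0+\rho_1}x(0y)(0z)\to 0(\mathrm{pcase}_{\sigma,\tau,\rho_0}xyz)$; $\mathrm{pcase}_{\sigma,\tau,\rho_0+\rho_1}x(1y)(1z)\to 1(\mathrm{pcase}_{\sigma,\tau,\rho_1}xyz)$; $\mathrm{pcase}_{\sigma,\tau,\rho_1\times\rho_2}x(y_1,y_2)(z_1,z_2)\to(\mathrm{pcase}\,x\,y_1z_1,\mathrm{pcase}\,x\,y_2z_2)$; $(\mathrm{pcase}_{\sigma,\tau,\rho_1\to\rho_2}xyz)w\to\mathrm{pcase}_{\sigma,\tau,\rho_2}x(yw)(zw)$. $\to^*$: reflexive transitive closure. A normal form is a term $N$ with no $N'$ such that $N\to N'$. Prefix order: $\preceq$ is the least relation on terms of the same type with $\Omega\preceq M$ for every $M$, $x\preceq x$ for every variable or constant $x$, $M\preceq M'\Rightarrow\lambda x.M\preceq\lambda x.M'$, and $M\preceq M',N\preceq N'\Rightarrow MN\preceq M'N'$. A normal form $A$ is a direct approximation of $M$ iff $A\preceq N$ for every $N$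 with $M\to^*N$. -}

module Defs where

open import Data.Nat using (ℕ; zero; suc)
open import Data.Fin using (Fin; zero; suc)
open import Data.List using (List; []; _∷_)
open import Data.Product using (Σ; ∃; _×_; _,_)
open import Relation.Nullary using (¬_)

-- Type expressions  σ ::= t | σ+σ | σ×σ | σ→σ | μt.σ | void
-- (de Bruijn: Ty n = type expressions with n free type variables)

data BinOp : Set where
  sum prod arr : BinOp

data Ty (n : ℕ) : Set where
  tvar : Fin n → Ty n
  void : Ty n
  node : BinOp → Ty n → Ty n → Ty n
  μ    : Ty (suc n) → Ty n

infixr 7 _⊕_
infixr 8 _⊗_
infixr 6 _⇒_

_⊕_ _⊗_ _⇒_ : ∀ {n} → Ty n → Ty n → Ty n
a ⊕ b = node sum a b
a ⊗ b = node prod a b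
a ⇒ b = node arr a b

Type : Set
Type = Ty 0

liftR : ∀ {m n} → (Fin m → Fin n) → Fin (suc m) → Fin (suc n)
liftR ρ zero    = zero
liftR ρ (suc i) = suc (ρ i)

renT : ∀ {m n} → (Fin m → Fin n) → Ty m → Ty n
renT ρ (tvar i)     = tvar (ρ i)
renT ρ void         = void
renT ρ (node o a b) = node o (renT ρ a) (renT ρ b)
renT ρ (μ a)        = μ (renT (liftR ρ) a)

liftS : ∀ {m n} → (Fin m → Ty n) → Fin (suc m) → Ty (suc n)
liftS s zero    = tvar zero
liftS s (suc i) = renT suc (s i)

subT : ∀ {m n} → (Fin m → Ty n) → Ty m → Ty n
subT s (tvar i)     = s i
subT s void         = void
subT s (node o a b) = node o (subT s a) (subT s b)
subT s (μ a)        = μ (subT (liftS s) a)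

_[_]ᵀ : ∀ {n} → Ty (suc n) → Ty n → Ty n
σ [ τ ]ᵀ = subT s σ
  where
  s : Fin (suc _) → Ty _
  s zero    = τ
  s (suc i) = tvar i

-- Head unfolding of a closed type: unfold μt.σ to σ[t:=μt.σ] until the
-- head is void or a binary constructor (non-contractive types such as
-- μt.t have no head unfolding).
data _↠_ : Type → Type → Set where
  ↠void : void ↠ void
  ↠node : ∀ {o a b} → node o a b ↠ node o a b
  ↠μ    : ∀ {σ ρ} → (σ [ μ σ ]ᵀ) ↠ ρ → μ σ ↠ ρ

-- The (possibly infinite) type tree of a closed type, given by the
-- label found at each finite path.
data Dir : Set where
  L R : Dir

data Label : Set where
  lvoid : Label
  lop   : BinOp → Label

data At : Type → List Dir → Label → Set where
  at-void : ∀ {σ} → σ ↠ void → At σ [] lvoid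
  at-node : ∀ {σ o a b} → σ ↠ node o a b → At σ [] (lop o)
  at-L    : ∀ {σ o a b p l} → σ ↠ node o a b → At a p l → At σ (L ∷ p) l
  at-R    : ∀ {σ o a b p l} → σ ↠ node o a b → At b p l → At σ (R ∷ p) l

_≈_ : Type → Type → Set
σ ≈ τ = ∀ p l → (At σ p l → At τ p l) × (At τ p l → At σ p l)

-- Terms (de Bruijn indices for variables; α-conversion is built in)

data Const : Set where
  c0 c1       : Type → Type → Const
  case pcase  : Type → Type → Type → Const
  pair fst snd : Type → Type → Const

constType : Const → Type
constType (c0 s t)      = s ⇒ (s ⊕ t)
constType (c1 s t)      = t ⇒ (s ⊕ t)
constType (case s t r)  = (s ⊕ t) ⇒ (s ⇒ r) ⇒ (t ⇒ r) ⇒ r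
constType (pcase s t r) = (s ⊕ t) ⇒ r ⇒ r ⇒ r
constType (pair s t)    = s ⇒ t ⇒ (s ⊗ t)
constType (fst s t)     = (s ⊗ t) ⇒ s
constType (snd s t)     = (s ⊗ t) ⇒ t

infixl 9 _·_

data Tm : Set where
  var : ℕ → Tm
  con : Const → Tm
  Ω   : Type → Tm
  lam : Type → Tm → Tm
  _·_ : Tm → Tm → Tm

-- typing contexts: types of the free variables (x^σ)
Ctx : Set
Ctx = List Type

data _∋_∶_ : Ctx → ℕ → Type → Set where
  here  : ∀ {Γ σ} → (σ ∷ Γ) ∋ zero ∶ σ
  there : ∀ {Γ σ τ i} → Γ ∋ i ∶ σ → (τ ∷ Γ) ∋ suc i ∶ σ

infix 4 _⊢_∶_
data _⊢_∶_ (Γ : Ctx) : Tm → Type → Set where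
  ⊢var  : ∀ {i σ} → Γ ∋ i ∶ σ → Γ ⊢ var i ∶ σ
  ⊢con  : ∀ c → Γ ⊢ con c ∶ constType c
  ⊢Ω    : ∀ σ → Γ ⊢ Ω σ ∶ σ
  ⊢lam  : ∀ {σ τ M} → (σ ∷ Γ) ⊢ M ∶ τ → Γ ⊢ lam σ M ∶ σ ⇒ τ
  ⊢app  : ∀ {σ τ M N} → Γ ⊢ M ∶ σ ⇒ τ → Γ ⊢ N ∶ σ → Γ ⊢ M · N ∶ τ
  ⊢conv : ∀ {σ τ M} → Γ ⊢ M ∶ σ → σ ≈ τ → Γ ⊢ M ∶ τ

liftr : (ℕ → ℕ) → ℕ → ℕ
liftr ρ zero    = zero
liftr ρ (suc i) = suc (ρ i)

ren : (ℕ → ℕ) → Tm → Tm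
ren ρ (var i)   = var (ρ i)
ren ρ (con c)   = con c
ren ρ (Ω σ)     = Ω σ
ren ρ (lam σ M) = lam σ (ren (liftr ρ) M)
ren ρ (M · N)   = ren ρ M · ren ρ N

lifts : (ℕ → Tm) → ℕ → Tm
lifts s zero    = var zero
lifts s (suc i) = ren suc (s i)

sub : (ℕ → Tm) → Tm → Tm
sub s (var i)   = s i
sub s (con c)   = con c
sub s (Ω σ)     = Ω σ
sub s (lam σ M) = lam σ (sub (lifts s) M)
sub s (M · N)   = sub s M · sub s N

_[_] : Tm → Tm → Tm
M [ N ] = sub s M
  where
  s : ℕ → Tm
  s zero    = N
  s (suc i) = var i

infix 3 _⟶_
data _⟶_ : Tm → Tm → Set where
  β      : ∀ {σ M N} → lam σ M · N ⟶ M [ N ]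
  appL   : ∀ {M M' N} → M ⟶ M' → M · N ⟶ M' · N
  appR   : ∀ {M N N'} → N ⟶ N' → M · N ⟶ M · N'
  ξ      : ∀ {σ M M'} → M ⟶ M' → lam σ M ⟶ lam σ M'
  case0  : ∀ {s t r a b x y z} →
           con (case s t r) · (con (c0 a b) · x) · y · z ⟶ y · x
  case1  : ∀ {s t r a b x y z} →
           con (case s t r) · (con (c1 a b) · x) · y · z ⟶ z · x
  fstβ   : ∀ {s t a b x y} → con (fst s t) · (con (pair a b) · x · y) ⟶ x
  sndβ   : ∀ {s t a b x y} → con (snd s t) · (con (pair a b) · x · y) ⟶ y
  pcase0 : ∀ {s t r a b x y z} →
           con (pcase s t r) · (con (c0 a b) · x) · y · z ⟶ y
  pcase1 : ∀ {s t r a b x y z} →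
           con (pcase s t r) · (con (c1 a b) · x) · y · z ⟶ z
  pcase00 : ∀ {s t r0 r1 a b a' b' x y z} →
           con (pcase s t (r0 ⊕ r1)) · x · (con (c0 a b) · y) · (con (c0 a' b') · z)
             ⟶ con (c0 r0 r1) · (con (pcase s t r0) · x · y · z)
  pcase11 : ∀ {s t r0 r1 a b a' b' x y z} →
           con (pcase s t (r0 ⊕ r1)) · x · (con (c1 a b) · y) · (con (c1 a' b') · z)
             ⟶ con (c1 r0 r1) · (con (pcase s t r1) · x · y · z)
  pcasePair : ∀ {s t r1 r2 a b a' b' x y1 y2 z1 z2} →
           con (pcase s t (r1 ⊗ r2)) · x · (con (pair a b) · y1 · y2)
                                         · (con (pair a' b') · z1 · z2)
             ⟶ con (pair r1 r2) · (con (pcase s t r1) · x · y1 · z1)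
                                · (con (pcase s t r2) · x · y2 · z2)
  pcaseArr : ∀ {s t r1 r2 x y z w} →
           con (pcase s t (r1 ⇒ r2)) · x · y · z · w
             ⟶ con (pcase s t r2) · x · (y · w) · (z · w)

infix 3 _⟶*_
data _⟶*_ : Tm → Tm → Set where
  refl* : ∀ {M} → M ⟶* M
  step* : ∀ {M N P} → M ⟶ N → N ⟶* P → M ⟶* P

Normal : Tm → Set
Normal N = ¬ (∃ λ N' → N ⟶ N')

data Atom : Tm → Set where
  atom-var : ∀ {i} → Atom (var i)
  atom-con : ∀ {c} → Atom (con c)
  atom-Ω   : ∀ {σ} → Atom (Ω σ)

infix 4 _⊢_⪯_∶_ _⊢_⊑_
data _⊢_⪯_∶_ (Γ : Ctx) : Tm → Tm → Type → Set where
  ⪯Ω    : ∀ {σ M} → Γ ⊢ M ∶ σ → Γ ⊢ Ω σ ⪯ M ∶ σ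
  ⪯atom : ∀ {a σ} → Atom a → Γ ⊢ a ∶ σ → Γ ⊢ a ⪯ a ∶ σ
  ⪯lam  : ∀ {σ τ M M'} → (σ ∷ Γ) ⊢ M ⪯ M' ∶ τ → Γ ⊢ lam σ M ⪯ lam σ M' ∶ σ ⇒ τ
  ⪯app  : ∀ {σ τ M M' N N'} → Γ ⊢ M ⪯ M' ∶ σ ⇒ τ → Γ ⊢ N ⪯ N' ∶ σ →
          Γ ⊢ M · N ⪯ M' · N' ∶ τ
  ⪯conv : ∀ {σ τ M M'} → Γ ⊢ M ⪯ M' ∶ σ → σ ≈ τ → Γ ⊢ M ⪯ M' ∶ τ

-- M ⪯ M' (written Γ ⊢ M ⊑ M', in context Γ): related and of the same type
_⊢_⊑_ : Ctx → Tm → Tm → Set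
Γ ⊢ M ⊑ M' = ∃ λ ρ → (Γ ⊢ M ⪯ M' ∶ ρ)

DirectApprox : Ctx → Tm → Tm → Set
DirectApprox Γ M A = Normal A × (∀ N → M ⟶* N → Γ ⊢ A ⊑ N)

IsLub : Ctx → Tm → Tm → Tm → Set
IsLub Γ A B C = (Γ ⊢ A ⊑ C) × (Γ ⊢ B ⊑ C)
              × (∀ D → Γ ⊢ A ⊑ D → Γ ⊢ B ⊑ D → Γ ⊢ C ⊑ D)

-- Two direct approximations A and B of M are prefixes of M, hence compatible:
-- wherever neither is Ω they have the same constructor. Their join C overlays
-- them, filling the Ω's of one with subterms of the other (relation Join).
--
-- 1. Typing is unique up to ≈, so prefixes of a common term have the same
--    type. Hence derivations of A ⪯ N and B ⪯ N combine into C ⪯ N for every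
--    common upper bound N: C is the least upper bound, and lies below every
--    reduct of M.
-- 2. C is normal. A redex of C either already occurs in A or B (β, and pcase
--    at an arrow type, whose pattern is fixed by the head alone), or C is a
--    redex that is stable, i.e. below every reduct of M. Stable redexes do not
--    exist: an erasing redex (case, fst, snd, pcase on an injection) makes
--    every term above it contract to a smaller term still above it (infinite
--    descent), and pushing pcase into an injection or a pair changes the
--    arity of the head spine, while the spines of A and B survive reduction.
module Submission where

open import Defs
open import Data.Product using (∃; ∃₂; _×_; _,_; proj₁; proj₂)
open import Data.Sum using (_⊎_; inj₁; inj₂)
import Data.Sum as Sum
open import Data.Empty using (⊥)
open import Data.List using (List; _∷_)
open import Data.Nat using (ℕ; zero; suc; _+_; _<_; s≤s)
open import Data.Nat.Properties
  using (<-trans; m≤m+n; m≤n+m; +-monoˡ-<; +-comm; module ≤-Reasoning)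
open import Data.Nat.Induction using (<-wellFounded)
open import Induction.WellFounded using (Acc; acc)
open import Relation.Nullary using (¬_)
open import Relation.Binary.PropositionalEquality using (_≡_; _≢_; refl; cong)

private
  variable
    Γ : Ctx
    σ σ' τ τ' ρ ρ' r0 r1 r2 s t : Type
    a b c c' m m' n n' q x y y' z z' : Tm
    k k' : Const
    i i' : ℕ
    p : List Dir
    l : Label

≈-refl : σ ≈ σ
≈-refl p l = (λ h → h) , (λ h → h)

≈-sym : σ ≈ τ → τ ≈ σ
≈-sym e p l = proj₂ (e p l) , proj₁ (e p l)

≈-trans : σ ≈ τ → τ ≈ ρ → σ ≈ ρ
≈-trans e f p l = (λ h → proj₁ (f p l) (proj₁ (e p l) h))
                , (λ h → proj₂ (e p l) (proj₂ (f p l) h))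

⇒-right : At (σ ⇒ τ) (R ∷ p) l → At τ p l
⇒-right (at-R ↠node h) = h

⇒-injʳ : (σ ⇒ τ) ≈ (σ' ⇒ τ') → τ ≈ τ'
⇒-injʳ e p l = (λ h → ⇒-right (proj₁ (e (R ∷ p) l) (at-R ↠node h)))
             , (λ h → ⇒-right (proj₂ (e (R ∷ p) l) (at-R ↠node h)))

⇒-congʳ : τ ≈ τ' → (σ ⇒ τ) ≈ (σ ⇒ τ')
⇒-congʳ e p l = transport e , transport (≈-sym e)
  where
  transport : ∀ {σ τ τ' p l} → τ ≈ τ' → At (σ ⇒ τ) p l → At (σ ⇒ τ') p l
  transport e (at-node ↠node) = at-node ↠node
  transport e (at-L ↠node h)  = at-L ↠node h
  transport {p = R ∷ p} {l} e (at-R ↠node h) = at-R ↠node (proj₁ (e p l) h)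

∋-unique : Γ ∋ i ∶ σ → Γ ∋ i ∶ τ → σ ≡ τ
∋-unique here      here      = refl
∋-unique (there h) (there h') = ∋-unique h h'

⊢-unique : Γ ⊢ a ∶ σ → Γ ⊢ a ∶ τ → σ ≈ τ
⊢-unique (⊢conv d e) d' = ≈-trans (≈-sym e) (⊢-unique d d')
⊢-unique d (⊢conv d' e) = ≈-trans (⊢-unique d d') e
⊢-unique (⊢var h) (⊢var h') with ∋-unique h h'
... | refl = ≈-refl
⊢-unique (⊢con k)    (⊢con .k)    = ≈-refl
⊢-unique (⊢Ω σ)      (⊢Ω .σ)      = ≈-refl
⊢-unique (⊢lam d)    (⊢lam d')    = ⇒-congʳ (⊢-unique d d')
⊢-unique (⊢app d _)  (⊢app d' _)  = ⇒-injʳ (⊢-unique d d')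

⪯-typeˡ : Γ ⊢ a ⪯ n ∶ ρ → Γ ⊢ a ∶ ρ
⪯-typeˡ (⪯Ω {σ} _)  = ⊢Ω σ
⪯-typeˡ (⪯atom _ d) = d
⪯-typeˡ (⪯lam d)    = ⊢lam (⪯-typeˡ d)
⪯-typeˡ (⪯app d d') = ⊢app (⪯-typeˡ d) (⪯-typeˡ d')
⪯-typeˡ (⪯conv d e) = ⊢conv (⪯-typeˡ d) e

⪯-typeʳ : Γ ⊢ a ⪯ n ∶ ρ → Γ ⊢ n ∶ ρ
⪯-typeʳ (⪯Ω d)      = d
⪯-typeʳ (⪯atom _ d) = d
⪯-typeʳ (⪯lam d)    = ⊢lam (⪯-typeʳ d)
⪯-typeʳ (⪯app d d') = ⊢app (⪯-typeʳ d) (⪯-typeʳ d')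
⪯-typeʳ (⪯conv d e) = ⊢conv (⪯-typeʳ d) e

⪯-refl : Γ ⊢ a ∶ ρ → Γ ⊢ a ⪯ a ∶ ρ
⪯-refl (⊢var h)    = ⪯atom atom-var (⊢var h)
⪯-refl (⊢con k)    = ⪯atom atom-con (⊢con k)
⪯-refl (⊢Ω σ)      = ⪯atom atom-Ω (⊢Ω σ)
⪯-refl (⊢lam d)    = ⪯lam (⪯-refl d)
⪯-refl (⊢app d d') = ⪯app (⪯-refl d) (⪯-refl d')
⪯-refl (⊢conv d e) = ⪯conv (⪯-refl d) e

⪯-retype : Γ ⊢ a ⪯ n ∶ ρ → Γ ⊢ b ⪯ n ∶ ρ' → Γ ⊢ b ⪯ n ∶ ρ
⪯-retype d d' = ⪯conv d' (⊢-unique (⪯-typeʳ d') (⪯-typeʳ d))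

Ω-below : Γ ⊢ Ω σ ⪯ n ∶ ρ → Γ ⊢ b ⪯ n ∶ ρ' → Γ ⊢ Ω σ ⪯ b ∶ ρ
Ω-below {σ = σ} d d' = ⪯conv (⪯Ω b∶σ) σ≈ρ
  where
  σ≈ρ : _ ≈ _
  σ≈ρ = ⊢-unique (⊢Ω σ) (⪯-typeˡ d)
  b∶σ : _ ⊢ _ ∶ σ
  b∶σ = ⊢conv (⪯-typeˡ d') (≈-trans (⊢-unique (⪯-typeʳ d') (⪯-typeʳ d)) (≈-sym σ≈ρ))

-- The untyped prefix order, the shadow of ⪯ used for the normality argument

infix 4 _≼_
data _≼_ : Tm → Tm → Set where
  ≼Ω   : Ω σ ≼ n
  ≼var : var i ≼ var i
  ≼con : con k ≼ con k
  ≼lam : m ≼ m' → lam σ m ≼ lam σ m'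
  ≼app : m ≼ m' → n ≼ n' → m · n ≼ m' · n'

⪯⇒≼ : Γ ⊢ a ⪯ n ∶ ρ → a ≼ n
⪯⇒≼ (⪯Ω _)             = ≼Ω
⪯⇒≼ (⪯atom atom-var _) = ≼var
⪯⇒≼ (⪯atom atom-con _) = ≼con
⪯⇒≼ (⪯atom atom-Ω _)   = ≼Ω
⪯⇒≼ (⪯lam d)           = ≼lam (⪯⇒≼ d)
⪯⇒≼ (⪯app d d')        = ≼app (⪯⇒≼ d) (⪯⇒≼ d')
⪯⇒≼ (⪯conv d _)        = ⪯⇒≼ d

data Join : Tm → Tm → Tm → Set where
  jΩl  : Join (Ω σ) b b
  jΩr  : Join a (Ω σ) a
  jvar : Join (var i) (var i) (var i)
  jcon : Join (con k) (con k) (con k)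
  jlam : Join m m' c → Join (lam σ m) (lam σ m') (lam σ c)
  japp : Join m m' c → Join n n' c' → Join (m · n) (m' · n') (c · c')

join-sym : Join a b c → Join b a c
join-sym jΩl        = jΩr
join-sym jΩr        = jΩl
join-sym jvar       = jvar
join-sym jcon       = jcon
join-sym (jlam j)   = jlam (join-sym j)
join-sym (japp j l) = japp (join-sym j) (join-sym l)

join-exists : a ≼ n → b ≼ n → ∃ (Join a b)
join-exists ≼Ω _                     = _ , jΩl
join-exists _ ≼Ω                     = _ , jΩr
join-exists ≼var ≼var                = _ , jvar
join-exists ≼con ≼con                = _ , jcon
join-exists (≼lam p) (≼lam p')       = _ , jlam (proj₂ (join-exists p p'))
join-exists (≼app p q) (≼app p' q')  =
  _ , japp (proj₂ (join-exists p p')) (proj₂ (join-exists q q'))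

join-least : Join a b c → a ≼ q → b ≼ q → c ≼ q
join-least jΩl        _          p'           = p'
join-least jΩr        p          _            = p
join-least jvar       p          _            = p
join-least jcon       p          _            = p
join-least (jlam j)   (≼lam p)   (≼lam p')    = ≼lam (join-least j p p')
join-least (japp j l) (≼app p q) (≼app p' q') = ≼app (join-least j p p') (join-least l q q')

join-⪯ : Join a b c → Γ ⊢ a ⪯ n ∶ ρ → Γ ⊢ b ⪯ n ∶ ρ' → Γ ⊢ c ⪯ n ∶ ρ
join-⪯ j (⪯conv d e) d' = ⪯conv (join-⪯ j d d') e
join-⪯ j d (⪯conv d' e) = join-⪯ j d d'
join-⪯ jΩl d d'         = ⪯-retype d d'
join-⪯ jΩr d _          = d
join-⪯ jvar d _         = d
join-⪯ jcon d _         = d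
join-⪯ (jlam j)   (⪯lam d)    (⪯lam d')     = ⪯lam (join-⪯ j d d')
join-⪯ (japp j l) (⪯app d e)  (⪯app d' e')  = ⪯app (join-⪯ j d d') (join-⪯ l e e')

join-upperˡ : Join a b c → Γ ⊢ a ⪯ n ∶ ρ → Γ ⊢ b ⪯ n ∶ ρ' → Γ ⊢ a ⪯ c ∶ ρ
join-upperˡ j (⪯conv d e) d' = ⪯conv (join-upperˡ j d d') e
join-upperˡ j d (⪯conv d' e) = join-upperˡ j d d'
join-upperˡ jΩl d d'         = Ω-below d d'
join-upperˡ jΩr d _          = ⪯-refl (⪯-typeˡ d)
join-upperˡ jvar d _         = ⪯-refl (⪯-typeˡ d)
join-upperˡ jcon d _         = ⪯-refl (⪯-typeˡ d)
join-upperˡ (jlam j)   (⪯lam d)   (⪯lam d')    = ⪯lam (join-upperˡ j d d')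
join-upperˡ (japp j l) (⪯app d e) (⪯app d' e') = ⪯app (join-upperˡ j d d') (join-upperˡ l e e')

join-upperʳ : Join a b c → Γ ⊢ a ⪯ n ∶ ρ → Γ ⊢ b ⪯ n ∶ ρ' → Γ ⊢ b ⪯ c ∶ ρ'
join-upperʳ j d d' = join-upperˡ (join-sym j) d' d

appL* : m ⟶* m' → m · n ⟶* m' · n
appL* refl*       = refl*
appL* (step* s r) = step* (appL s) (appL* r)

appR* : n ⟶* n' → m · n ⟶* m · n'
appR* refl*       = refl*
appR* (step* s r) = step* (appR s) (appR* r)

ξ* : m ⟶* m' → lam σ m ⟶* lam σ m'
ξ* refl*       = refl*
ξ* (step* s r) = step* (ξ s) (ξ* r)

Stable : Tm → Tm → Set
Stable c n = ∀ q → n ⟶* q → c ≼ q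

approx-stable : DirectApprox Γ n a → Stable a n
approx-stable (_ , below) q r = ⪯⇒≼ (proj₂ (below q r))

join-stable : Join a b c → Stable a n → Stable b n → Stable c n
join-stable j sa sb q r = join-least j (sa q r) (sb q r)

stable-body : Stable (lam σ m) (lam σ' n) → Stable m n
stable-body st q r with st _ (ξ* r)
... | ≼lam p = p

stable-fun : Stable (m · n) (m' · n') → Stable m m'
stable-fun st q r with st _ (appL* r)
... | ≼app p _ = p

stable-arg : Stable (m · n) (m' · n') → Stable n n'
stable-arg st q r with st _ (appR* r)
... | ≼app _ p = p

body-normal : Normal (lam σ m) → Normal m
body-normal nf (_ , s) = nf (_ , ξ s)

fun-normal : Normal (m · n) → Normal m
fun-normal nf (_ , s) = nf (_ , appL s)

arg-normal : Normal (m · n) → Normal n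
arg-normal nf (_ , s) = nf (_ , appR s)

data Spine (k : Const) : ℕ → Tm → Set where
  sp0 : Spine k zero (con k)
  spS : Spine k i m → Spine k (suc i) (m · n)

join-spine : Join a b c → Spine k i c → Spine k i a ⊎ Spine k i b
join-spine jΩl        sp       = inj₂ sp
join-spine jΩr        sp       = inj₁ sp
join-spine jcon       sp0      = inj₁ sp0
join-spine (japp j _) (spS sp) = Sum.map spS spS (join-spine j sp)

spine-≼ : Spine k i a → a ≼ q → Spine k i q
spine-≼ sp0      ≼con       = sp0
spine-≼ (spS sp) (≼app p _) = spS (spine-≼ sp p)

spine-arity : Spine k i a → Spine k' i' a → i ≡ i'
spine-arity sp0      sp0       = refl
spine-arity (spS sp) (spS sp') = cong suc (spine-arity sp sp')

-- number of nodes; the measure for the infinite-descent argument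
size : Tm → ℕ
size (var _)   = 1
size (con _)   = 1
size (Ω _)     = 1
size (lam _ m) = suc (size m)
size (m · n)   = suc (size m + size n)

fun< : ∀ m n → size m < size (m · n)
fun< m n = s≤s (m≤m+n (size m) (size n))

arg< : ∀ m n → size n < size (m · n)
arg< m n = s≤s (m≤n+m (size n) (size m))

fun-mono< : ∀ m m' n → size m < size m' → size (m · n) < size (m' · n)
fun-mono< m m' n lt = s≤s (+-monoˡ-< (size n) lt)

size-swap : ∀ m n → size (m · n) ≡ size (n · m)
size-swap m n = cong suc (+-comm (size m) (size n))

inner-arg< : ∀ f g x → size x < size (f · (g · x))
inner-arg< f g x = <-trans (arg< g x) (arg< f (g · x))

case0-contractum< : ∀ f g x y z → size (y · x) < size (f · (g · x) · y · z)
case0-contractum< f g x y z = begin-strict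
  size (y · x)           ≡⟨ size-swap y x ⟩
  size (x · y)           <⟨ fun-mono< x (f · (g · x)) y (inner-arg< f g x) ⟩
  size (f · (g · x) · y) <⟨ fun< (f · (g · x) · y) z ⟩
  size (f · (g · x) · y · z) ∎
  where open ≤-Reasoning

case1-contractum< : ∀ f g x y z → size (z · x) < size (f · (g · x) · y · z)
case1-contractum< f g x y z = begin-strict
  size (z · x)               ≡⟨ size-swap z x ⟩
  size (x · z)               <⟨ fun-mono< x (f · (g · x) · y) z x<fgxy ⟩
  size (f · (g · x) · y · z) ∎
  where
  open ≤-Reasoning
  x<fgxy : size x < size (f · (g · x) · y)
  x<fgxy = <-trans (inner-arg< f g x) (fun< (f · (g · x)) y)

pair-fst< : ∀ f g x y → size x < size (f · (g · x · y))
pair-fst< f g x y = <-trans (arg< g x) (<-trans (fun< (g · x) y) (arg< f (g · x · y)))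

pair-snd< : ∀ f g x y → size y < size (f · (g · x · y))
pair-snd< f g x y = <-trans (arg< (g · x) y) (arg< f (g · x · y))

Erasing : Tm → Set
Erasing c = ∀ n → c ≼ n → ∃ λ n' → (n ⟶ n') × size n' < size n

-- infinite descent: the contractum of n is again above c, and smaller
erasing-unstable : Erasing c → ¬ Stable c n
erasing-unstable {c} {n} erasing = descend n (<-wellFounded (size n))
  where
  descend : ∀ n → Acc _<_ (size n) → ¬ Stable c n
  descend n (acc smaller) st with erasing n (st n refl*)
  ... | n' , s , n'<n = descend n' (smaller n'<n) (λ q r → st q (step* s r))

case0-erasing : Erasing (con (case s t ρ) · (con (c0 σ τ) · x) · y · z)
case0-erasing (con k · (con k' · x) · y · z) (≼app (≼app (≼app ≼con (≼app ≼con _)) _) _) =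
  y · x , case0 , case0-contractum< (con k) (con k') x y z

case1-erasing : Erasing (con (case s t ρ) · (con (c1 σ τ) · x) · y · z)
case1-erasing (con k · (con k' · x) · y · z) (≼app (≼app (≼app ≼con (≼app ≼con _)) _) _) =
  z · x , case1 , case1-contractum< (con k) (con k') x y z

fst-erasing : Erasing (con (fst s t) · (con (pair σ τ) · x · y))
fst-erasing (con k · (con k' · x · y)) (≼app ≼con (≼app (≼app ≼con _) _)) =
  x , fstβ , pair-fst< (con k) (con k') x y

snd-erasing : Erasing (con (snd s t) · (con (pair σ τ) · x · y))
snd-erasing (con k · (con k' · x · y)) (≼app ≼con (≼app (≼app ≼con _) _)) =
  y , sndβ , pair-snd< (con k) (con k') x y

pcase0-erasing : Erasing (con (pcase s t ρ) · (con (c0 σ τ) · x) · y · z)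
pcase0-erasing (con k · (con k' · x) · y · z) (≼app (≼app (≼app ≼con (≼app ≼con _)) _) _) =
  y , pcase0 , <-trans (arg< (con k · (con k' · x)) y) (fun< (con k · (con k' · x) · y) z)

pcase1-erasing : Erasing (con (pcase s t ρ) · (con (c1 σ τ) · x) · y · z)
pcase1-erasing (con k · (con k' · x) · y · z) (≼app (≼app (≼app ≼con (≼app ≼con _)) _) _) =
  z , pcase1 , arg< (con k · (con k' · x) · y) z

-- every term above c contracts to a term whose head spine has an arity
-- different from i (the arity of the head spine of c)
ArityChanging : ℕ → Tm → Set
ArityChanging i c = ∀ n → c ≼ n → ∃₂ λ n' k' → ∃ λ i' → (n ⟶ n') × Spine k' i' n' × i ≢ i'

-- the head spine of c stems from a or b, whose spines survive all reduction
arity-changing-unstable : Join a b c → Spine k i c → ArityChanging i c →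
                          Stable a n → Stable b n → ⊥
arity-changing-unstable j sp changing sa sb
  with changing _ (join-stable j sa sb _ refl*)
... | n' , _ , _ , s , sp' , i≢i' with join-spine j sp
...   | inj₁ spa = i≢i' (spine-arity (spine-≼ spa (sa n' (step* s refl*))) sp')
...   | inj₂ spb = i≢i' (spine-arity (spine-≼ spb (sb n' (step* s refl*))) sp')

-- pcase pushed into injections or pairs: the head becomes 0, 1 or pair
pcase00-changing : ArityChanging 3
  (con (pcase s t (r0 ⊕ r1)) · x · (con (c0 σ τ) · y) · (con (c0 σ' τ') · z))
pcase00-changing _ (≼app (≼app (≼app ≼con _) (≼app ≼con _)) (≼app ≼con _)) =
  _ , _ , _ , pcase00 , spS sp0 , λ ()

pcase11-changing : ArityChanging 3
  (con (pcase s t (r0 ⊕ r1)) · x · (con (c1 σ τ) · y) · (con (c1 σ' τ') · z))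
pcase11-changing _ (≼app (≼app (≼app ≼con _) (≼app ≼con _)) (≼app ≼con _)) =
  _ , _ , _ , pcase11 , spS sp0 , λ ()

pcasePair-changing : ArityChanging 3
  (con (pcase s t (r1 ⊗ r2)) · x · (con (pair σ τ) · y · y') · (con (pair σ' τ') · z · z'))
pcasePair-changing _ (≼app (≼app (≼app ≼con _) (≼app (≼app ≼con _) _)) (≼app (≼app ≼con _) _)) =
  _ , _ , _ , pcasePair , spS (spS sp0) , λ ()

join-normal : Join a b c → Normal a → Normal b → Stable a n → Stable b n → Normal c
join-normal jΩl _  nb _ _ = nb
join-normal jΩr na _  _ _ = na
join-normal jvar _ _ _ _ (_ , ())
join-normal jcon _ _ _ _ (_ , ())
join-normal (jlam j) na nb sa sb (_ , ξ s) with sa _ refl*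
... | ≼lam _ = join-normal j (body-normal na) (body-normal nb)
                           (stable-body sa) (stable-body sb) (_ , s)
join-normal (japp j _) na nb sa sb (_ , appL s) with sa _ refl*
... | ≼app _ _ = join-normal j (fun-normal na) (fun-normal nb)
                             (stable-fun sa) (stable-fun sb) (_ , s)
join-normal (japp _ l) na nb sa sb (_ , appR s) with sa _ refl*
... | ≼app _ _ = join-normal l (arg-normal na) (arg-normal nb)
                             (stable-arg sa) (stable-arg sb) (_ , s)
-- a β-redex or a pcase at arrow type is determined by its head, which
-- comes from a or b
join-normal (japp jΩl _)      _  nb _ _ (_ , β) = nb (_ , β)
join-normal (japp jΩr _)      na _  _ _ (_ , β) = na (_ , β)
join-normal (japp (jlam _) _) na _  _ _ (_ , β) = na (_ , β)
join-normal j@(japp _ _) na nb _ _ (_ , pcaseArr)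
  with join-spine j (spS (spS (spS (spS sp0))))
... | inj₁ (spS (spS (spS (spS sp0)))) = na (_ , pcaseArr)
... | inj₂ (spS (spS (spS (spS sp0)))) = nb (_ , pcaseArr)
-- all other redexes would be stable
join-normal j@(japp _ _) _ _ sa sb (_ , case0)  = erasing-unstable case0-erasing (join-stable j sa sb)
join-normal j@(japp _ _) _ _ sa sb (_ , case1)  = erasing-unstable case1-erasing (join-stable j sa sb)
join-normal j@(japp _ _) _ _ sa sb (_ , fstβ)   = erasing-unstable fst-erasing (join-stable j sa sb)
join-normal j@(japp _ _) _ _ sa sb (_ , sndβ)   = erasing-unstable snd-erasing (join-stable j sa sb)
join-normal j@(japp _ _) _ _ sa sb (_ , pcase0) = erasing-unstable pcase0-erasing (join-stable j sa sb)
join-normal j@(japp _ _) _ _ sa sb (_ , pcase1) = erasing-unstable pcase1-erasing (join-stable j sa sb)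
join-normal j@(japp _ _) _ _ sa sb (_ , pcase00) =
  arity-changing-unstable j (spS (spS (spS sp0))) pcase00-changing sa sb
join-normal j@(japp _ _) _ _ sa sb (_ , pcase11) =
  arity-changing-unstable j (spS (spS (spS sp0))) pcase11-changing sa sb
join-normal j@(japp _ _) _ _ sa sb (_ , pcasePair) =
  arity-changing-unstable j (spS (spS (spS sp0))) pcasePair-changing sa sb

mainTheorem6 : (Γ : Ctx) (τ : Type) (M A B : Tm) → Γ ⊢ M ∶ τ →
    DirectApprox Γ M A → DirectApprox Γ M B →
    ∃ λ C → IsLub Γ A B C × Normal C × DirectApprox Γ M C
mainTheorem6 Γ τ M A B _ approxA@(nA , A⊑) approxB@(nB , B⊑)
  with join-exists (approx-stable approxA M refl*) (approx-stable approxB M refl*)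
... | C , j = C , lub , normal , normal , below
  where
  A⪯M : Γ ⊢ A ⪯ M ∶ proj₁ (A⊑ M refl*)
  A⪯M = proj₂ (A⊑ M refl*)
  B⪯M : Γ ⊢ B ⪯ M ∶ proj₁ (B⊑ M refl*)
  B⪯M = proj₂ (B⊑ M refl*)
  lub : IsLub Γ A B C
  lub = (_ , join-upperˡ j A⪯M B⪯M) , (_ , join-upperʳ j A⪯M B⪯M)
      , λ { D (_ , A⪯D) (_ , B⪯D) → _ , join-⪯ j A⪯D B⪯D }
  normal : Normal C
  normal = join-normal j nA nB (approx-stable approxA) (approx-stable approxB)
  below : ∀ N → M ⟶* N → Γ ⊢ C ⊑ N
  below N r = _ , join-⪯ j (proj₂ (A⊑ N r)) (proj₂ (B⊑ N r))
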